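{- Let $n\ge 2$ and let $f$ be an $s$-symmetric nested canalizing function on $n$ variables with $r$ layers. Then $r\le s\le\min\{2r,n\}$.
   Context: $\oplus$ is addition modulo 2. A Boolean function $f:\mathbb{F}_2^n\to\mathbb{F}_2$ is nested canalizing (NCF) if for some permutation $\sigma$ of $\{1,\dots,n\}$ and $a_i,b_i\in\mathbb{F}_2$: $f=b_1$ if $x_{\sigma(1)}=a_1$; $f=b_k$ if $x_{\sigma(i)}=a_i\oplus1$ for $i<k$ and $x_{\sigma(k)}=a_k$ ($k\le n$); and $f=b_n\oplus 1$ if $x_{\sigma(i)}=a_i\oplus 1$ for all $i$. It is known that for $n\ge 2$ every NCF can be uniquely written as $f=M_1(M_2(\cdots(M_{r-1}(M_r\oplus1)\oplus1)\cdots)\oplus1)\oplus b$ with $M_i=\prod_{j=1}^{k_i}(x_{i_j}\oplus a_{i_j})$, $k_i\ge1$ for $i<r$, $k_r\ge2$, $k_1+\cdots+k_r=n$, each variable appearing in exactly one $M_i$; $r$ is the number of layers. Symmetry: for $i,j\in\{1,\dots,n\}$ write $i\sim_f j$ if $f$ is unchanged when $x_i$ and $x_j$ are swapped; this is an equivalence relation, and $f$ is $s$-symmetric if $\{1,\dots,n\}$ has exactly $s$ equivalence classes under $\sim_f$. -}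

module Defs where

open import Data.Bool using (Bool; true; false; not; _∧_; _xor_; if_then_else_)
open import Data.Nat using (ℕ; zero; suc; _∸_)
open import Data.Fin using (Fin; toℕ; _<_)
open import Data.Fin.Permutation using (Permutation′; _⟨$⟩ʳ_)
open import Data.List using (List; []; _∷_; map; foldr)
open import Data.List using () renaming (allFin to allFinL)
open import Data.Product using (Σ; ∃; _×_; _,_)
open import Relation.Binary.PropositionalEquality using (_≡_; _≢_)
open import Relation.Nullary using (does)
open import Function.Bundles using (_⇔_)
import Data.Fin as F

-- Boolean functions F₂ⁿ → F₂ (F₂ = Bool, ⊕ = xor, product = ∧)
BoolFun : ℕ → Set
BoolFun n = (Fin n → Bool) → Bool

-- Nested canalizing function, literally as in the definition:
-- permutation σ, canalizing inputs a, canalized outputs b.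
IsNCFWith : {n : ℕ} → BoolFun n → Permutation′ n → (Fin n → Bool) → (Fin n → Bool) → Set
IsNCFWith {n} f σ a b =
  (∀ (x : Fin n → Bool) (k : Fin n) →
     (∀ (i : Fin n) → i < k → x (σ ⟨$⟩ʳ i) ≡ not (a i)) →
     x (σ ⟨$⟩ʳ k) ≡ a k → f x ≡ b k)
  ×
  (∀ (x : Fin n → Bool) →
     (∀ (i : Fin n) → x (σ ⟨$⟩ʳ i) ≡ not (a i)) →
     ∀ (k : Fin n) → toℕ k ≡ n ∸ 1 → f x ≡ not (b k))

IsNCF : {n : ℕ} → BoolFun n → Set
IsNCF {n} f = Σ (Permutation′ n) λ σ → Σ (Fin n → Bool) λ a → Σ (Fin n → Bool) λ b → IsNCFWith f σ a b

-- Layer form.  L j = index of the layer M_i containing variable x_j,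
-- a j = the constant a_j with factor (x_j ⊕ a_j), b the final constant.
-- M_i(x) = ∏_{j : L j = i} (x_j ⊕ a_j)
layerM : {n r : ℕ} → (Fin n → Fin r) → (Fin n → Bool) → Fin r → (Fin n → Bool) → Bool
layerM {n} L a i x =
  foldr (λ j acc → if does (L j F.≟ i) then (x j xor a j) ∧ acc else acc) true (allFinL n)

-- nest [M₁,…,M_r] = M₁(M₂(⋯(M_{r-1}(M_r ⊕ 1) ⊕ 1)⋯) ⊕ 1)
nest : List Bool → Bool
nest [] = false
nest (m ∷ []) = m
nest (m ∷ m' ∷ ms) = m ∧ not (nest (m' ∷ ms))

layerEval : {n r : ℕ} → (Fin n → Fin r) → (Fin n → Bool) → Bool → (Fin n → Bool) → Bool
layerEval {n} {r} L a b x = nest (map (λ i → layerM L a i x) (allFinL r)) xor b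

HasLayers : {n : ℕ} → BoolFun n → ℕ → Set
HasLayers {n} f r =
  Σ (Fin n → Fin r) λ L → Σ (Fin n → Bool) λ a → Σ Bool λ b →
    (∀ (i : Fin r) → ∃ λ j → L j ≡ i)
    × (∀ (i : Fin r) → toℕ i ≡ r ∸ 1 → ∃ λ j → ∃ λ j' → j ≢ j' × L j ≡ i × L j' ≡ i)
    × (∀ x → f x ≡ layerEval L a b x)

swapIn : {n : ℕ} → Fin n → Fin n → (Fin n → Bool) → (Fin n → Bool)
swapIn i j x k = if does (k F.≟ i) then x j else (if does (k F.≟ j) then x i else x k)

SymVars : {n : ℕ} → BoolFun n → Fin n → Fin n → Set
SymVars f i j = ∀ x → f (swapIn i j x) ≡ f x

-- f is s-symmetric: the classes of ∼_f are in bijection with Fin s,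
-- i.e. there is a surjective class map c with i ∼_f j ⇔ c i ≡ c j.
SSymmetric : {n : ℕ} → BoolFun n → ℕ → Set
SSymmetric {n} f s =
  Σ (Fin n → Fin s) λ c →
    (∀ (t : Fin s) → ∃ λ i → c i ≡ t)
    × (∀ (i j : Fin n) → SymVars f i j ⇔ (c i ≡ c j))

-- Write f = nest (M₁, …, M_r) ⊕ b.  At any point the value of nest is the parity of
-- the index of the first vanishing monomial (r if there is none).  Swapping two
-- variables with the same layer and the same constant a permutes the factors of each
-- M_k, so the class of a variable is determined by this pair: s ≤ 2r, and s ≤ n since
-- classes are nonempty.  If x_i lies in layer p and x_j in a later layer, there is a
-- point with x_j = a_i whose first vanishing monomial is M_{p+1} or M_{p+3} (or none,
-- with r = p + 3); swapping x_i and x_j makes M_p the first vanishing monomial, which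
-- changes the parity.  So every class lies in one layer, and r ≤ s.
module Submission where

open import Defs
open import Data.Nat using (ℕ; _≤_; _*_; _⊓_)
open import Data.Product using (_×_)

open import Data.Bool using (Bool; true; false; not; _∧_; _xor_; if_then_else_)
open import Data.Bool.Properties as Bool
  using (not-involutive; not-¬; ¬-not; xor-assoc; xor-same; xor-identityʳ)
open import Data.Nat as ℕ using (zero; suc; _<_; _∸_; s≤s; z≤n)
open import Data.Nat.Properties
  using (<-cmp; <-trans; <-irrefl; ≤-refl; <⇒≤; ≤-<-trans; ≤∧≢⇒<; ⊓-glb; n<1+n)
open import Data.Fin as F using (Fin; toℕ; fromℕ<; combine; _≟_)
open import Data.Fin.Properties
  using (toℕ-injective; toℕ<n; toℕ-fromℕ<; injective⇒≤; combine-injective; 2↔Bool)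
open import Data.Fin.Permutation.Components using (transpose; transpose-inverse)
open import Data.List using ([]; _∷_; map; foldr; tabulate; allFin)
open import Data.List.Properties using (map-cong; map-tabulate)
open import Data.List.Membership.Propositional using (_∈_)
open import Data.List.Membership.Propositional.Properties using (∈-allFin)
open import Data.List.Relation.Unary.Any using (here; there)
open import Data.Product using (∃; _,_; proj₁; proj₂)
open import Data.Sum using (_⊎_; inj₁; inj₂)
open import Data.Empty using (⊥-elim)
open import Function using (_∘_; id)
open import Function.Bundles using (_⇔_; Equivalence; Inverse)
open import Relation.Binary.Definitions using (tri<; tri≈; tri>)
open import Relation.Binary.PropositionalEquality
open import Relation.Nullary using (¬_; yes; no; does)

isOdd : ℕ → Bool
isOdd zero = false
isOdd (suc k) = not (isOdd k)

isOdd-suc-suc : ∀ k → isOdd (suc (suc k)) ≡ isOdd k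
isOdd-suc-suc k = not-involutive (isOdd k)

xor-cancelʳ : ∀ u v → (u xor v) xor v ≡ u
xor-cancelʳ u v = begin
  (u xor v) xor v ≡⟨ xor-assoc u v v ⟩
  u xor (v xor v) ≡⟨ cong (u xor_) (xor-same v) ⟩
  u xor false     ≡⟨ xor-identityʳ u ⟩
  u               ∎
  where open ≡-Reasoning

∧≡true : ∀ {u v} → u ∧ v ≡ true → u ≡ true × v ≡ true
∧≡true {true} {true} _ = refl , refl

xor-injectiveʳ : ∀ {u v} w → u xor w ≡ v xor w → u ≡ v
xor-injectiveʳ {u} {v} w e = begin
  u               ≡⟨ xor-cancelʳ u w ⟨
  (u xor w) xor w ≡⟨ cong (_xor w) e ⟩
  (v xor w) xor w ≡⟨ xor-cancelʳ v w ⟩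
  v               ∎
  where open ≡-Reasoning

≡true⇔⇒≡ : ∀ {u v} → (u ≡ true → v ≡ true) → (v ≡ true → u ≡ true) → u ≡ v
≡true⇔⇒≡ {true}  {true}  _ _ = refl
≡true⇔⇒≡ {true}  {false} f _ = sym (f refl)
≡true⇔⇒≡ {false} {true}  _ g = g refl
≡true⇔⇒≡ {false} {false} _ _ = refl

nest-true∷ : ∀ ms → nest (true ∷ ms) ≡ not (nest ms)
nest-true∷ [] = refl
nest-true∷ (_ ∷ _) = refl

nest-false∷ : ∀ ms → nest (false ∷ ms) ≡ false
nest-false∷ [] = refl
nest-false∷ (_ ∷ _) = refl

nest-tabulate : ∀ {r} (g : Fin r → Bool) (k : ℕ) → k ≤ r →
  (∀ i → toℕ i < k → g i ≡ true) → (∀ i → toℕ i ≡ k → g i ≡ false) →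
  nest (tabulate g) ≡ isOdd k
nest-tabulate {zero}  g zero    _         _     _  = refl
nest-tabulate {suc r} g zero    _         _     at rewrite at F.zero refl = nest-false∷ (tabulate (g ∘ F.suc))
nest-tabulate {suc r} g (suc k) (s≤s k≤r) below at rewrite below F.zero (s≤s z≤n) =
  trans (nest-true∷ (tabulate (g ∘ F.suc))) (cong not (nest-tabulate (g ∘ F.suc) k k≤r
    (λ i i<k → below (F.suc i) (s≤s i<k)) (λ i i≡k → at (F.suc i) (cong suc i≡k))))

transpose-invariant : ∀ {n} {B : Set} (P : Fin n → B) {i j : Fin n} → P i ≡ P j →
  ∀ m → P (transpose i j m) ≡ P m
transpose-invariant P {i} {j} Pi≡Pj m with m ≟ i
... | yes refl = sym Pi≡Pj
... | no _ with m ≟ j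
...   | yes refl = Pi≡Pj
...   | no _ = refl

swapIn-transpose : ∀ {n} (i j : Fin n) (x : Fin n → Bool) m → swapIn i j x m ≡ x (transpose i j m)
swapIn-transpose i j x m with m ≟ i
... | yes _ = refl
... | no _ with m ≟ j
...   | yes _ = refl
...   | no _ = refl

swapIn-other : ∀ {n} {i j m : Fin n} (x : Fin n → Bool) → m ≢ i → m ≢ j → swapIn i j x m ≡ x m
swapIn-other {i = i} {j} {m} x m≢i m≢j with m ≟ i
... | yes m≡i = ⊥-elim (m≢i m≡i)
... | no _ with m ≟ j
...   | yes m≡j = ⊥-elim (m≢j m≡j)
...   | no _ = refl

swapIn-left : ∀ {n} (i j : Fin n) (x : Fin n → Bool) → swapIn i j x i ≡ x j
swapIn-left i j x with i ≟ i
... | yes _ = refl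
... | no i≢i = ⊥-elim (i≢i refl)

module Layers {n r : ℕ} (L : Fin n → Fin r) (a : Fin n → Bool) where

  factor : (Fin n → Bool) → Fin n → Bool
  factor x m = x m xor a m

  private
    step : Fin r → (Fin n → Bool) → Fin n → Bool → Bool
    step k x m acc = if does (L m ≟ k) then factor x m ∧ acc else acc

    foldr-true : ∀ k x ms → (∀ m → m ∈ ms → L m ≡ k → factor x m ≡ true) →
      foldr (step k x) true ms ≡ true
    foldr-true k x [] _ = refl
    foldr-true k x (m ∷ ms) H with L m ≟ k
    ... | yes Lm≡k rewrite H m (here refl) Lm≡k = foldr-true k x ms (λ m′ → H m′ ∘ there)
    ... | no _ = foldr-true k x ms (λ m′ → H m′ ∘ there)

    foldr-true⁻ : ∀ k x ms → foldr (step k x) true ms ≡ true →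
      ∀ m → m ∈ ms → L m ≡ k → factor x m ≡ true
    foldr-true⁻ k x (m′ ∷ ms) e m m∈ Lm≡k with L m′ ≟ k | m∈
    ... | yes _   | here refl = proj₁ (∧≡true e)
    ... | yes _   | there m∈ms = foldr-true⁻ k x ms (proj₂ (∧≡true {factor x m′} e)) m m∈ms Lm≡k
    ... | no Lm≢k | here refl = ⊥-elim (Lm≢k Lm≡k)
    ... | no _    | there m∈ms = foldr-true⁻ k x ms e m m∈ms Lm≡k

  layerM-true : ∀ k x → (∀ m → L m ≡ k → factor x m ≡ true) → layerM L a k x ≡ true
  layerM-true k x H = foldr-true k x (allFin n) (λ m _ → H m)

  layerM-true⁻ : ∀ k x → layerM L a k x ≡ true → ∀ m → L m ≡ k → factor x m ≡ true
  layerM-true⁻ k x e m = foldr-true⁻ k x (allFin n) e m (∈-allFin m)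

  layerM-false : ∀ k x m → L m ≡ k → factor x m ≡ false → layerM L a k x ≡ false
  layerM-false k x m Lm≡k fm≡false with layerM L a k x in eq
  ... | false = refl
  ... | true = ⊥-elim (not-¬ fm≡false (layerM-true⁻ k x eq m Lm≡k))

  layerM-reindex : ∀ k (π : Fin n → Fin n) → (∀ m → L (π m) ≡ L m) → (∀ m → a (π m) ≡ a m) →
    ∀ {x y} → (∀ m → y m ≡ x (π m)) → layerM L a k x ≡ true → layerM L a k y ≡ true
  layerM-reindex k π Lπ aπ {x} {y} y≗x∘π e = layerM-true k y λ m Lm≡k → begin
    y m xor a m         ≡⟨ cong₂ _xor_ (y≗x∘π m) (sym (aπ m)) ⟩
    x (π m) xor a (π m) ≡⟨ layerM-true⁻ k x e (π m) (trans (Lπ m) Lm≡k) ⟩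
    true                ∎
    where open ≡-Reasoning

  sameLayer⇒SymVars : ∀ b {i j} → L i ≡ L j → a i ≡ a j → SymVars (layerEval L a b) i j
  sameLayer⇒SymVars b {i} {j} Li≡Lj ai≡aj x =
    cong (λ ms → nest ms xor b) (map-cong layerM-swapIn (allFin r))
    where
    layerM-swapIn : ∀ k → layerM L a k (swapIn i j x) ≡ layerM L a k x
    layerM-swapIn k = ≡true⇔⇒≡
      (layerM-reindex k (transpose j i) (transpose-invariant L (sym Li≡Lj))
        (transpose-invariant a (sym ai≡aj)) {swapIn i j x} {x}
        (λ m → trans (cong x (sym (transpose-inverse i j))) (sym (swapIn-transpose i j x (transpose j i m)))))
      (layerM-reindex k (transpose i j) (transpose-invariant L Li≡Lj) (transpose-invariant a ai≡aj)
        {x} {swapIn i j x} (swapIn-transpose i j x))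

  data FirstFalseLayer (x : Fin n → Bool) : ℕ → Set where
    all-true : (∀ m → factor x m ≡ true) → FirstFalseLayer x r
    at : ∀ m → factor x m ≡ false → (∀ m′ → toℕ (L m′) < toℕ (L m) → factor x m′ ≡ true) →
      FirstFalseLayer x (toℕ (L m))

  FirstFalseLayer-below : ∀ {x k} → FirstFalseLayer x k → ∀ m → toℕ (L m) < k → factor x m ≡ true
  FirstFalseLayer-below (all-true H) m _ = H m
  FirstFalseLayer-below (at _ _ H) = H

  layerEval-firstFalse : ∀ b {x k} → FirstFalseLayer x k → layerEval L a b x ≡ isOdd k xor b
  layerEval-firstFalse b {x} {k} ff = cong (_xor b) (begin
    nest (map M (allFin r)) ≡⟨ cong nest (map-tabulate id M) ⟩
    nest (tabulate M)       ≡⟨ nest-tabulate M k (k≤r ff) below (vanishesAt ff) ⟩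
    isOdd k                 ∎)
    where
    open ≡-Reasoning
    M : Fin r → Bool
    M k′ = layerM L a k′ x
    k≤r : ∀ {k} → FirstFalseLayer x k → k ≤ r
    k≤r (all-true _) = ≤-refl
    k≤r (at m _ _) = <⇒≤ (toℕ<n (L m))
    below : ∀ k′ → toℕ k′ < k → M k′ ≡ true
    below k′ k′<k = layerM-true k′ x λ m Lm≡k′ →
      FirstFalseLayer-below ff m (subst (λ t → toℕ t < k) (sym Lm≡k′) k′<k)
    vanishesAt : ∀ {k} → FirstFalseLayer x k → ∀ k′ → toℕ k′ ≡ k → M k′ ≡ false
    vanishesAt (all-true _) k′ k′≡r = ⊥-elim (<-irrefl k′≡r (toℕ<n k′))
    vanishesAt (at m fm≡false _) k′ k′≡Lm =
      layerM-false k′ x m (toℕ-injective (sym k′≡Lm)) fm≡false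

module DifferentLayers {n r : ℕ} (L : Fin n → Fin r) (a : Fin n → Bool)
  (nonempty : ∀ (k : Fin r) → ∃ λ m → L m ≡ k)
  (lastPair : ∀ (k : Fin r) → toℕ k ≡ r ∸ 1 → ∃ λ m → ∃ λ m′ → m ≢ m′ × L m ≡ k × L m′ ≡ k)
  {i j : Fin n} (Li<Lj : toℕ (L i) < toℕ (L j)) where

  open Layers L a

  P Q : ℕ
  P = toℕ (L i)
  Q = toℕ (L j)

  d : Bool
  d = a i xor a j

  -- The factors of probe w: x_j gets d, so that after swapping x_i and x_j the factor
  -- of x_i vanishes; x_w gets 0 unless w = j; all other factors are 1.
  target : Fin n → Fin n → Bool
  target w m = if does (m ≟ j) then d else if does (m ≟ w) then false else true

  probe : Fin n → Fin n → Bool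
  probe w m = target w m xor a m

  factor-probe : ∀ w m → factor (probe w) m ≡ target w m
  factor-probe w m = xor-cancelʳ (target w m) (a m)

  target-j : ∀ w → target w j ≡ d
  target-j w with j ≟ j
  ... | yes _ = refl
  ... | no j≢j = ⊥-elim (j≢j refl)

  target-self : ∀ {w} → d ≡ false ⊎ w ≢ j → target w w ≡ false
  target-self {w} d≡false⊎w≢j with w ≟ j | d≡false⊎w≢j
  ... | yes _   | inj₁ d≡false = d≡false
  ... | yes w≡j | inj₂ w≢j = ⊥-elim (w≢j w≡j)
  ... | no _    | _ with w ≟ w
  ...   | yes _ = refl
  ...   | no w≢w = ⊥-elim (w≢w refl)

  probe-j : ∀ w → probe w j ≡ a i
  probe-j w = trans (cong (_xor a j) (target-j w)) (xor-cancelʳ (a i) (a j))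

  target-below : ∀ w m → (Q < toℕ (L w) → d ≡ true) → toℕ (L m) < toℕ (L w) → target w m ≡ true
  target-below w m j-below Lm<Lw with m ≟ j
  ... | yes refl = j-below Lm<Lw
  ... | no _ with m ≟ w
  ...   | yes m≡w = ⊥-elim (<-irrefl (cong (toℕ ∘ L) m≡w) Lm<Lw)
  ...   | no _ = refl

  probe-firstFalse : ∀ w → d ≡ false ⊎ w ≢ j → (Q < toℕ (L w) → d ≡ true) →
    FirstFalseLayer (probe w) (toℕ (L w))
  probe-firstFalse w self j-below = at w (trans (factor-probe w w) (target-self self))
    λ m Lm<Lw → trans (factor-probe w m) (target-below w m j-below Lm<Lw)

  target-allTrue : d ≡ true → ∀ m → target j m ≡ true
  target-allTrue d≡true m with m ≟ j
  ... | yes refl = d≡true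
  ... | no _ = refl

  probe-allTrue : d ≡ true → FirstFalseLayer (probe j) r
  probe-allTrue d≡true = all-true λ m → trans (factor-probe j m) (target-allTrue d≡true m)

  swapped-firstFalse : ∀ {x k} → FirstFalseLayer x k → P < k → x j ≡ a i →
    FirstFalseLayer (swapIn i j x) P
  swapped-firstFalse {x} ff P<k xj≡ai = at i swapped-i below
    where
    swapped-i : factor (swapIn i j x) i ≡ false
    swapped-i = begin
      swapIn i j x i xor a i ≡⟨ cong (_xor a i) (trans (swapIn-left i j x) xj≡ai) ⟩
      a i xor a i            ≡⟨ xor-same (a i) ⟩
      false                  ∎
      where open ≡-Reasoning
    below : ∀ m → toℕ (L m) < P → factor (swapIn i j x) m ≡ true
    below m Lm<P = trans (cong (_xor a m) (swapIn-other x
        (λ m≡i → <-irrefl (cong (toℕ ∘ L) m≡i) Lm<P)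
        (λ m≡j → <-irrefl (cong (toℕ ∘ L) m≡j) (<-trans Lm<P Li<Lj))))
      (FirstFalseLayer-below ff m (<-trans Lm<P P<k))

  OddProbe : Set
  OddProbe = ∃ λ w → ∃ λ k → P < k × isOdd k ≡ not (isOdd P) × FirstFalseLayer (probe w) k

  oddProbe-1+ : ∀ w {k} → k ≡ suc P → FirstFalseLayer (probe w) k → OddProbe
  oddProbe-1+ w refl ff = w , suc P , n<1+n P , refl , ff

  oddProbe-3+ : ∀ w {k} → k ≡ suc (suc (suc P)) → FirstFalseLayer (probe w) k → OddProbe
  oddProbe-3+ w refl ff =
    w , _ , <-trans (n<1+n P) (<-trans (n<1+n _) (n<1+n _)) , isOdd-suc-suc (suc P) , ff

  variableAt : ∀ {k} → k < r → ∃ λ w → toℕ (L w) ≡ k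
  variableAt k<r = proj₁ (nonempty (fromℕ< k<r)) ,
    trans (cong toℕ (proj₂ (nonempty (fromℕ< k<r)))) (toℕ-fromℕ< k<r)

  ≢j-byLayer : ∀ {w} → toℕ (L w) ≢ Q → w ≢ j
  ≢j-byLayer Lw≢Q w≡j = Lw≢Q (cong (toℕ ∘ L) w≡j)

  lastLayerOther : suc Q ≡ r → ∃ λ w → w ≢ j × L w ≡ L j
  lastLayerOther 1+Q≡r with lastPair (L j) (cong (_∸ 1) 1+Q≡r)
  ... | m , m′ , m≢m′ , Lm , Lm′ with m ≟ j
  ...   | yes m≡j = m′ , (λ m′≡j → m≢m′ (trans m≡j (sym m′≡j))) , Lm′
  ...   | no m≢j = m , m≢j , Lm

  -- The first vanishing layer is p + 1, except when d = 1 and x_j lies in layer p + 1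
  -- which is not the last one: then it is layer p + 3, or none if r = p + 3.
  oddProbe : OddProbe
  oddProbe with d Bool.≟ true | Q ℕ.≟ suc P
  ... | no d≢true | _ =
    let (w , Lw≡1+P) = variableAt (≤-<-trans Li<Lj (toℕ<n (L j)))
        Lj<Lw = λ Q<Lw → ⊥-elim (<-irrefl refl (≤-<-trans Li<Lj (subst (Q <_) Lw≡1+P Q<Lw)))
    in oddProbe-1+ w Lw≡1+P (probe-firstFalse w (inj₁ (¬-not d≢true)) Lj<Lw)
  ... | yes d≡true | no Q≢1+P =
    let (w , Lw≡1+P) = variableAt (<-trans (≤∧≢⇒< Li<Lj (Q≢1+P ∘ sym)) (toℕ<n (L j)))
        w≢j = ≢j-byLayer λ Lw≡Q → Q≢1+P (trans (sym Lw≡Q) Lw≡1+P)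
    in oddProbe-1+ w Lw≡1+P (probe-firstFalse w (inj₂ w≢j) (λ _ → d≡true))
  ... | yes d≡true | yes Q≡1+P with suc Q ℕ.≟ r
  ...   | yes 1+Q≡r =
    let (w , w≢j , Lw≡Lj) = lastLayerOther 1+Q≡r
    in oddProbe-1+ w (trans (cong toℕ Lw≡Lj) Q≡1+P) (probe-firstFalse w (inj₂ w≢j) (λ _ → d≡true))
  ...   | no 1+Q≢r with suc (suc Q) ℕ.≟ r
  ...     | yes 2+Q≡r =
    oddProbe-3+ j (trans (sym 2+Q≡r) (cong (suc ∘ suc) Q≡1+P)) (probe-allTrue d≡true)
  ...     | no 2+Q≢r =
    let (w , Lw≡2+Q) = variableAt (≤∧≢⇒< (≤∧≢⇒< (toℕ<n (L j)) 1+Q≢r) 2+Q≢r)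
        w≢j = ≢j-byLayer λ Lw≡Q → <-irrefl (trans (sym Lw≡Q) Lw≡2+Q) (<-trans (n<1+n Q) (n<1+n _))
    in oddProbe-3+ w (trans Lw≡2+Q (cong (suc ∘ suc) Q≡1+P))
         (probe-firstFalse w (inj₂ w≢j) (λ _ → d≡true))

  differentLayers⇒¬SymVars : ∀ b → ¬ SymVars (layerEval L a b) i j
  differentLayers⇒¬SymVars b sym-ij with oddProbe
  ... | w , k , P<k , k-odd , ff = not-¬ refl (begin
    isOdd P       ≡⟨ xor-injectiveʳ b (begin
      isOdd P xor b                          ≡⟨ layerEval-firstFalse b swapped ⟨
      layerEval L a b (swapIn i j (probe w)) ≡⟨ sym-ij (probe w) ⟩
      layerEval L a b (probe w)              ≡⟨ layerEval-firstFalse b ff ⟩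
      isOdd k xor b                          ∎) ⟩
    isOdd k       ≡⟨ k-odd ⟩
    not (isOdd P) ∎)
    where
    open ≡-Reasoning
    swapped : FirstFalseLayer (swapIn i j (probe w)) P
    swapped = swapped-firstFalse ff P<k (probe-j w)

factors-through⇒≤ : ∀ {n m k : ℕ} (g : Fin n → Fin m) (h : Fin n → Fin k) →
  (∀ t → ∃ λ i → g i ≡ t) → (∀ i j → h i ≡ h j → g i ≡ g j) → m ≤ k
factors-through⇒≤ {n} {m} g h g-onto h⇒g = injective⇒≤ {f = h ∘ pick} λ {t} {t′} e →
  trans (sym (proj₂ (g-onto t))) (trans (h⇒g (pick t) (pick t′) e) (proj₂ (g-onto t′)))
  where
  pick : Fin m → Fin n
  pick t = proj₁ (g-onto t)

SymVars-resp-≗ : ∀ {n} {f g : BoolFun n} → (∀ x → f x ≡ g x) →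
  ∀ {i j} → SymVars f i j → SymVars g i j
SymVars-resp-≗ f≗g sym-ij x = trans (sym (f≗g _)) (trans (sym-ij x) (f≗g x))

module LayeredSymmetry {n r s : ℕ} {f : BoolFun n} (L : Fin n → Fin r) (a : Fin n → Bool) (b : Bool)
  (nonempty : ∀ (k : Fin r) → ∃ λ m → L m ≡ k)
  (lastPair : ∀ (k : Fin r) → toℕ k ≡ r ∸ 1 → ∃ λ m → ∃ λ m′ → m ≢ m′ × L m ≡ k × L m′ ≡ k)
  (f≗ : ∀ x → f x ≡ layerEval L a b x)
  (c : Fin n → Fin s) (c-sym : ∀ i j → SymVars f i j ⇔ (c i ≡ c j)) where

  open DifferentLayers L a nonempty lastPair using (differentLayers⇒¬SymVars)

  sameClass⇒sameLayer : ∀ i j → c i ≡ c j → L i ≡ L j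
  sameClass⇒sameLayer i j ci≡cj with <-cmp (toℕ (L i)) (toℕ (L j))
  ... | tri< Li<Lj _ _ = ⊥-elim (differentLayers⇒¬SymVars Li<Lj b
        (SymVars-resp-≗ f≗ (Equivalence.from (c-sym i j) ci≡cj)))
  ... | tri≈ _ Li≡Lj _ = toℕ-injective Li≡Lj
  ... | tri> _ _ Lj<Li = ⊥-elim (differentLayers⇒¬SymVars Lj<Li b
        (SymVars-resp-≗ f≗ (Equivalence.from (c-sym j i) (sym ci≡cj))))

  label : Fin n → Fin (2 * r)
  label m = combine (Inverse.from 2↔Bool (a m)) (L m)

  sameLabel⇒sameClass : ∀ i j → label i ≡ label j → c i ≡ c j
  sameLabel⇒sameClass i j li≡lj = Equivalence.to (c-sym i j)
    (SymVars-resp-≗ (sym ∘ f≗) (Layers.sameLayer⇒SymVars L a b Li≡Lj ai≡aj))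
    where
    open Inverse 2↔Bool using (to; from; strictlyInverseˡ)
    ai≡aj : a i ≡ a j
    ai≡aj = trans (sym (strictlyInverseˡ (a i)))
      (trans (cong to (proj₁ (combine-injective _ _ _ _ li≡lj))) (strictlyInverseˡ (a j)))
    Li≡Lj : L i ≡ L j
    Li≡Lj = proj₂ (combine-injective (from (a i)) _ (from (a j)) _ li≡lj)

proposition4p8 : (n : ℕ) → 2 ≤ n → (f : BoolFun n) → IsNCF f →
    (r s : ℕ) → HasLayers f r → SSymmetric f s →
    r ≤ s × s ≤ (2 * r) ⊓ n
proposition4p8 n _ f _ r s (L , a , b , nonempty , lastPair , f≗) (c , c-onto , c-sym) =
  factors-through⇒≤ L c nonempty sameClass⇒sameLayer ,
  ⊓-glb (factors-through⇒≤ c label c-onto sameLabel⇒sameClass)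
        (factors-through⇒≤ c id c-onto (λ _ _ → cong c))
  where
  open LayeredSymmetry L a b nonempty lastPair f≗ c c-sym
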